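{- Let $(W,S)$ be a Coxeter system. If $I\subseteq S$ and $X\subseteq D_I^W=\{x\in W:\mathrm{Des}(x)=I\}$, then $X$ is ascent-compatible.
   Context: $\ell$ is the Coxeter length; $s\in S$ is a (left) descent of $w\in W$ if $\ell(sw)<\ell(w)$ and an ascent otherwise; $\mathrm{Des}(w)$ is the set of left descents. A quadruple $(u,v,s,t)$ with $u,v\in W$, $s,t\in S$ is aligned if $s$ is an ascent of $u$, $t$ is an ascent of $v$, and $u^{ -1}su=v^{ -1}tv$. A subset $X\subseteq W$ is ascent-compatible if for all $u,v\in X$ and $s,t\in S$ with $(u,v,s,t)$ aligned, $su\in X$ if and only if $tv\in X$. -}

module Defs where

open import Level using (Level; _⊔_) renaming (suc to lsuc)
open import Algebra.Bundles using (Group)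
open import Algebra.Morphism.Structures using (module GroupMorphisms)
open import Data.Nat using (ℕ; zero; suc; _≤_; _<_)
open import Data.List using (List; []; _∷_; length; foldr)
open import Data.Product using (Σ; ∃; _×_; _,_)
open import Relation.Binary.PropositionalEquality using (_≡_)
open import Relation.Nullary using (¬_)
open import Relation.Unary using (Pred; _∈_; _∉_; _⊆_)

module _ {c ℓ : Level} (G : Group c ℓ) where
  open Group G
  pow : Carrier → ℕ → Carrier
  pow x zero    = ε
  pow x (suc n) = x ∙ pow x n

-- A Coxeter system (W,S): W is a group, S a set of generators
-- (given by an injective map ι : S → W) with a Coxeter matrix m
-- (m s s = 1, m s t = m t s ≥ 2 for s ≠ t, and m s t = 0 encodes ∞),
-- such that W has the presentation ⟨ S | (s t)^{m(s,t)} = 1 ⟩: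
-- the relations hold in W, S generates W, and every assignment of S into a
-- group G satisfying the relations extends to a group homomorphism W → G.
record CoxeterSystem (c ℓ : Level) : Set (lsuc (c ⊔ ℓ)) where
  field
    W      : Group c ℓ
    S      : Set c
    ι      : S → Group.Carrier W
    m      : S → S → ℕ
    m-diag : ∀ s → m s s ≡ 1
    m-sym  : ∀ s t → m s t ≡ m t s
    m-off  : ∀ s t → ¬ (s ≡ t) → ¬ (m s t ≡ 1)
    ι-inj  : ∀ s t → Group._≈_ W (ι s) (ι t) → s ≡ t
    relations  : ∀ s t → Group._≈_ W (pow W (Group._∙_ W (ι s) (ι t)) (m s t)) (Group.ε W)
    generation : ∀ (w : Group.Carrier W) →
                 ∃ λ (ws : List S) → Group._≈_ W (foldr (λ x y → Group._∙_ W (ι x) y) (Group.ε W) ws) w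
    universal  : (G : Group c ℓ) (f : S → Group.Carrier G) →
                 (∀ s t → Group._≈_ G (pow G (Group._∙_ G (f s) (f t)) (m s t)) (Group.ε G)) →
                 Σ (Group.Carrier W → Group.Carrier G) λ φ →
                   GroupMorphisms.IsGroupHomomorphism (Group.rawGroup W) (Group.rawGroup G) φ
                   × (∀ s → Group._≈_ G (φ (ι s)) (f s))

module Coxeter {c ℓ : Level} (C : CoxeterSystem c ℓ) where
  open CoxeterSystem C
  open Group W renaming (Carrier to Wc)

  evalWord : List S → Wc
  evalWord = foldr (λ x y → ι x ∙ y) ε

  HasLength : Wc → ℕ → Set (c ⊔ ℓ)
  HasLength w n = (∃ λ ws → length ws ≡ n × evalWord ws ≈ w)
                × (∀ ws → evalWord ws ≈ w → n ≤ length ws)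

  IsDescent : S → Wc → Set (c ⊔ ℓ)
  IsDescent s w = ∃ λ a → ∃ λ b → HasLength (ι s ∙ w) a × HasLength w b × a < b

  IsAscent : S → Wc → Set (c ⊔ ℓ)
  IsAscent s w = ¬ IsDescent s w

  D : {i : Level} → Pred S i → Pred Wc (c ⊔ ℓ ⊔ i)
  D I x = (I ⊆ λ s → IsDescent s x) × ((λ s → IsDescent s x) ⊆ I)

  Aligned : Wc → Wc → S → S → Set (c ⊔ ℓ)
  Aligned u v s t = IsAscent s u × IsAscent t v
                  × (u ⁻¹ ∙ ι s ∙ u) ≈ (v ⁻¹ ∙ ι t ∙ v)

  AscentCompatible : {i : Level} → Pred Wc i → Set (c ⊔ ℓ ⊔ i)
  AscentCompatible X = ∀ u v s t → u ∈ X → v ∈ X → Aligned u v s t →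
                       ((ι s ∙ u) ∈ X → (ι t ∙ v) ∈ X) × ((ι t ∙ v) ∈ X → (ι s ∙ u) ∈ X)

module Submission where

-- The universal property sends every generator to the nontrivial element of ℤ/2,
-- giving a sign character with sign w = ℓ(w) mod 2; hence ℓ(s w) ≢ ℓ(w), and s is
-- an ascent of exactly one of w and s w. If u and s u both lie in D_I with s an
-- ascent of u, then s ∈ Des(s u) = I = Des(u), a contradiction. So no aligned
-- quadruple in X ⊆ D_I ever leaves X, and ascent-compatibility holds vacuously.
-- Lengths are only known to exist up to double negation (least element of a
-- nonempty set of naturals), which suffices since every goal here is ⊥.

open import Defs
open import Level using (Level; _⊔_; Lift; lift; lower)
open import Algebra.Bundles using (Group; CommutativeRing)
open import Algebra.Morphism.Structures using (module GroupMorphisms)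
open import Relation.Unary using (Pred; _⊆_)
open import Data.Bool using (Bool; true; false; not)
open import Data.Bool.Properties using (xor-∧-commutativeRing; not-¬)
open import Data.Nat using (ℕ; zero; suc; _≤_)
open import Data.Nat.Properties using (≮⇒≥; ≤-antisym)
open import Data.Nat.Induction using (<-rec)
open import Data.List using ([]; _∷_; length)
open import Data.Product using (∃; _×_; _,_; proj₁; proj₂)
open import Data.Empty using (⊥-elim)
open import Relation.Nullary using (¬_)
open import Relation.Binary.PropositionalEquality as ≡ using (_≡_; _≢_; refl)

module _ {a b : Level} (G : Group a b) where
  open Group G renaming (refl to ≈-refl; sym to ≈-sym; trans to ≈-trans)

  liftGroup : (c ℓ : Level) → Group (a ⊔ c) (b ⊔ ℓ)
  liftGroup c ℓ = record
    { Carrier = Lift c Carrier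
    ; _≈_     = λ x y → Lift ℓ (lower x ≈ lower y)
    ; _∙_     = λ x y → lift (lower x ∙ lower y)
    ; ε       = lift ε
    ; _⁻¹     = λ x → lift (lower x ⁻¹)
    ; isGroup = record
      { isMonoid = record
        { isSemigroup = record
          { isMagma = record
            { isEquivalence = record
              { refl  = lift ≈-refl
              ; sym   = λ p → lift (≈-sym (lower p))
              ; trans = λ p q → lift (≈-trans (lower p) (lower q))
              }
            ; ∙-cong = λ p q → lift (∙-cong (lower p) (lower q))
            }
          ; assoc = λ x y z → lift (assoc (lower x) (lower y) (lower z))
          }
        ; identity = (λ x → lift (identityˡ (lower x))) , (λ x → lift (identityʳ (lower x)))
        }
      ; inverse = (λ x → lift (inverseˡ (lower x))) , (λ x → lift (inverseʳ (lower x)))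
      ; ⁻¹-cong = λ p → lift (⁻¹-cong (lower p))
      }
    }

ℤ₂ : (c ℓ : Level) → Group c ℓ
ℤ₂ = liftGroup (CommutativeRing.+-group xor-∧-commutativeRing)

parity : ℕ → Bool
parity zero    = false
parity (suc n) = not (parity n)

¬¬-least : ∀ {p} (P : ℕ → Set p) {n} → P n → ¬ ¬ (∃ λ m → P m × (∀ k → P k → m ≤ k))
¬¬-least P {n} = <-rec (λ n → P n → ¬ ¬ _)
  (λ n rec pn ¬least → ¬least (n , pn , λ k pk → ≮⇒≥ (λ k<n → rec k<n pk ¬least))) n

module CoxeterProperties {c ℓ : Level} (C : CoxeterSystem c ℓ) where
  open CoxeterSystem C
  open Group W hiding (refl) renaming (Carrier to Wc)
  open Coxeter C

  ι-square : ∀ s → ι s ∙ ι s ≈ ε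
  ι-square s = trans (sym (identityʳ _)) (≡.subst (λ k → pow W (ι s ∙ ι s) k ≈ ε) (m-diag s) (relations s s))

  ι-cancelˡ : ∀ s u → ι s ∙ (ι s ∙ u) ≈ u
  ι-cancelˡ s u = trans (sym (assoc _ _ _)) (trans (∙-congʳ (ι-square s)) (identityˡ u))

  ¬¬-hasLength : ∀ w → ¬ ¬ (∃ λ n → HasLength w n)
  ¬¬-hasLength w ¬len with generation w
  ... | ws , ws≈w = ¬¬-least (λ n → ∃ λ ws → length ws ≡ n × evalWord ws ≈ w) (ws , refl , ws≈w)
    λ { (n , word , least) → ¬len (n , word , λ vs vs≈w → least (length vs) (vs , refl , vs≈w)) }

  HasLength-resp-≈ : ∀ {w w′ n} → w ≈ w′ → HasLength w n → HasLength w′ n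
  HasLength-resp-≈ w≈w′ ((ws , len , ws≈w) , least) =
    (ws , len , trans ws≈w w≈w′) , λ vs vs≈w′ → least vs (trans vs≈w′ (sym w≈w′))

  private
    sgnHom = universal (ℤ₂ c ℓ) (λ _ → lift true) (λ s t → lift (pow-false (m s t)))
      where
      pow-false : ∀ n → lower (pow (ℤ₂ c ℓ) (lift false) n) ≡ false
      pow-false zero    = refl
      pow-false (suc n) = pow-false n
    open GroupMorphisms.IsGroupHomomorphism (proj₁ (proj₂ sgnHom))

  sign : Wc → Bool
  sign w = lower (proj₁ sgnHom w)

  sign-cong : ∀ {x y} → x ≈ y → sign x ≡ sign y
  sign-cong x≈y = lower (⟦⟧-cong x≈y)

  sign-ι∙ : ∀ s x → sign (ι s ∙ x) ≡ not (sign x)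
  sign-ι∙ s x rewrite lower (homo (ι s) x) | lower (proj₂ (proj₂ sgnHom) s) = refl

  sign-evalWord : ∀ ws → sign (evalWord ws) ≡ parity (length ws)
  sign-evalWord []       = lower ε-homo
  sign-evalWord (s ∷ ws) = ≡.trans (sign-ι∙ s (evalWord ws)) (≡.cong not (sign-evalWord ws))

  sign-HasLength : ∀ {w n} → HasLength w n → sign w ≡ parity n
  sign-HasLength ((ws , refl , ws≈w) , _) = ≡.trans (≡.sym (sign-cong ws≈w)) (sign-evalWord ws)

  HasLength-ι∙-≢ : ∀ {s u a b} → HasLength u a → HasLength (ι s ∙ u) b → a ≢ b
  HasLength-ι∙-≢ {s} {u} ℓu ℓsu refl = not-¬ (sign-HasLength ℓsu)
    (≡.trans (sign-ι∙ s u) (≡.cong not (sign-HasLength ℓu)))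

  ascent⇒¬ascent-ι∙ : ∀ {s u} → IsAscent s u → ¬ IsAscent s (ι s ∙ u)
  ascent⇒¬ascent-ι∙ {s} {u} asc asc′ = ¬¬-hasLength u λ { (a , ℓu) → ¬¬-hasLength (ι s ∙ u) λ { (b , ℓsu) →
    HasLength-ι∙-≢ ℓu ℓsu (≤-antisym
      (≮⇒≥ λ b<a → asc (b , a , ℓsu , ℓu , b<a))
      (≮⇒≥ λ a<b → asc′ (a , b , HasLength-resp-≈ (sym (ι-cancelˡ s u)) ℓu , ℓsu , a<b))) } }

  D-ascent-step : ∀ {i} {I : Pred S i} {s u} → D I u → D I (ι s ∙ u) → ¬ IsAscent s u
  D-ascent-step (I⊆Des-u , _) (_ , Des-su⊆I) asc =
    ascent⇒¬ascent-ι∙ asc (λ desc → asc (I⊆Des-u (Des-su⊆I desc)))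

proposition3p2 : {c ℓ i j : Level} (C : CoxeterSystem c ℓ) →
                 let open CoxeterSystem C in
                 (I : Pred S i) (X : Pred (Group.Carrier W) j) →
                 X ⊆ Coxeter.D C I → Coxeter.AscentCompatible C X
proposition3p2 C I X X⊆D u v s t u∈X v∈X (asc-s , asc-t , _) =
  (λ su∈X → ⊥-elim (D-ascent-step (X⊆D u∈X) (X⊆D su∈X) asc-s)) ,
  (λ tv∈X → ⊥-elim (D-ascent-step (X⊆D v∈X) (X⊆D tv∈X) asc-t))
  where open CoxeterProperties C
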